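{- There exists an oracle $A$ such that (the set $A$, which lies in $\mathrm{P}^A$) $A$ is not $A$-scalable and $\mathrm{census}_A\in\mathrm{FP}^A$.
   Context: Strings are over $\Sigma=\{0,1\}$, with $\le$ the standard lexicographic order. $\mathrm{census}_A(1^n)=|\{x\in A:|x|=n\}|$. A set is rankable in $\mathrm{FP}^X$ if its ranking function $x\mapsto|\{y\le x:y\in$ set$\}|$ is computable by a deterministic polynomial-time oracle transducer with oracle $X$. A $\mathrm{P}^X$-isomorphism is a bijection $\phi:\Sigma^*\to\Sigma^*$ with $\phi,\phi^{ -1}\in\mathrm{FP}^X$. A set is $X$-scalable if there is a $\mathrm{P}^X$-isomorphism mapping it onto some set rankable in $\mathrm{FP}^X$. -}

module Defs where

open import Data.Bool using (Bool; true; false; _∧_; not; if_then_else_)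
open import Data.Nat using (ℕ; zero; suc; _+_; _*_; _^_; _<ᵇ_)
open import Data.Nat.Properties using (_≟_)
open import Data.List using (List; []; _∷_; length; map; concatMap; upTo; replicate; reverse; _++_; foldl)
open import Data.Fin using (Fin)
open import Data.Maybe using (Maybe; just; nothing)
open import Data.Product using (Σ; ∃; _×_; _,_)
open import Relation.Nullary using (¬_; yes; no)
open import Relation.Binary.PropositionalEquality using (_≡_)

-- Strings over Σ = {0,1}  (false = 0, true = 1)

Word : Set
Word = List Bool

Lang : Set
Lang = Word → Bool

wordsOfLength : ℕ → List Word
wordsOfLength zero    = [] ∷ []
wordsOfLength (suc n) = map (false ∷_) (wordsOfLength n) ++ map (true ∷_) (wordsOfLength n)

-- lexicographic ≤ on words (used only for words of equal length)
lex≤ : Word → Word → Bool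
lex≤ []          _           = true
lex≤ (_ ∷ _)     []          = false
lex≤ (false ∷ x) (true ∷ y)  = true
lex≤ (true ∷ x)  (false ∷ y) = false
lex≤ (false ∷ x) (false ∷ y) = lex≤ x y
lex≤ (true ∷ x)  (true ∷ y)  = lex≤ x y

_≤std_ : Word → Word → Bool
x ≤std y with length x ≟ length y
... | yes _ = lex≤ x y
... | no  _ = length x <ᵇ length y

countᵇ : (Word → Bool) → List Word → ℕ
countᵇ p []       = 0
countᵇ p (y ∷ ys) = if p y then suc (countᵇ p ys) else countᵇ p ys

wordsUpTo : ℕ → List Word
wordsUpTo n = concatMap wordsOfLength (upTo (suc n))

rank : Lang → Word → ℕ
rank S x = countᵇ (λ y → S y ∧ (y ≤std x)) (wordsUpTo (length x))

-- census_A(1^n) = |{ x ∈ A : |x| = n }|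
census : Lang → ℕ → ℕ
census A n = countᵇ A (wordsOfLength n)

val : Word → ℕ
val = foldl (λ acc b → (if b then 1 else 0) + 2 * acc) 0

-- Two semi-infinite tapes (work/input-output tape and oracle query tape)
-- over {blank, 0, 1}.  In every step the machine sees its state, the two
-- scanned symbols and the oracle's answer to the word currently on the
-- query tape, and either halts or writes/moves on both tapes.

data Sym : Set where
  blank b0 b1 : Sym

data Move : Set where
  left right stay : Move

data Action (n : ℕ) : Set where
  halt : Action n
  go   : Fin n → Sym → Move → Sym → Move → Action n

record OTM : Set where
  field
    nStates : ℕ
    start   : Fin nStates
    δ       : Fin nStates → Sym → Sym → Bool → Action nStates

record Tape : Set where
  constructor tape
  field
    lft  : List Sym   -- cells left of the head, nearest first
    cur  : Sym
    rgt  : List Sym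

headOf : List Sym → Sym
headOf []      = blank
headOf (s ∷ _) = s

tailOf : List Sym → List Sym
tailOf []      = []
tailOf (_ ∷ s) = s

moveTape : Move → Tape → Tape
moveTape left  (tape [] c r)      = tape [] c r
moveTape left  (tape (l ∷ ls) c r) = tape ls l (c ∷ r)
moveTape right (tape l c r)       = tape (c ∷ l) (headOf r) (tailOf r)
moveTape stay  t                  = t

writeTape : Sym → Tape → Tape
writeTape s (tape l _ r) = tape l s r

toSym : Bool → Sym
toSym false = b0
toSym true  = b1

bitsPrefix : List Sym → Word
bitsPrefix []          = []
bitsPrefix (blank ∷ _) = []
bitsPrefix (b0 ∷ s)    = false ∷ bitsPrefix s
bitsPrefix (b1 ∷ s)    = true ∷ bitsPrefix s

queryWord : Tape → Word
queryWord (tape l c r) = bitsPrefix (reverse l ++ c ∷ r)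

outputOf : Tape → Word
outputOf (tape _ c r) = bitsPrefix (c ∷ r)

inputTape : Word → Tape
inputTape x = tape [] (headOf (map toSym x)) (tailOf (map toSym x))

emptyTape : Tape
emptyTape = tape [] blank []

runFor : Lang → (M : OTM) → ℕ → Fin (OTM.nStates M) → Tape → Tape → Maybe Word
runFor X M zero    q w qt = nothing
runFor X M (suc t) q w qt with OTM.δ M q (Tape.cur w) (Tape.cur qt) (X (queryWord qt))
... | halt = just (outputOf w)
... | go q' s m s' m' = runFor X M t q' (moveTape m (writeTape s w)) (moveTape m' (writeTape s' qt))

run : Lang → (M : OTM) → ℕ → Word → Maybe Word
run X M t x = runFor X M t (OTM.start M) (inputTape x) emptyTape

FP : Lang → (Word → Word) → Set
FP X f = Σ OTM λ M → Σ ℕ λ c → Σ ℕ λ k →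
  ∀ x → run X M (c * length x ^ k + c) x ≡ just (f x)

FPℕ : Lang → (Word → ℕ) → Set
FPℕ X f = Σ OTM λ M → Σ ℕ λ c → Σ ℕ λ k →
  ∀ x → Σ Word λ y → run X M (c * length x ^ k + c) x ≡ just y × val y ≡ f x

CensusInFP : Lang → Lang → Set
CensusInFP X A = Σ OTM λ M → Σ ℕ λ c → Σ ℕ λ k →
  ∀ n → Σ Word λ y → run X M (c * n ^ k + c) (replicate n true) ≡ just y × val y ≡ census A n

RankableIn : Lang → Lang → Set
RankableIn X B = FPℕ X (rank B)

IsPIso : Lang → (Word → Word) → (Word → Word) → Set
IsPIso X φ ψ = (∀ x → ψ (φ x) ≡ x) × (∀ y → φ (ψ y) ≡ y) × FP X φ × FP X ψ

Scalable : Lang → Lang → Set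
Scalable X A = Σ Lang λ B → Σ (Word → Word) λ φ → Σ (Word → Word) λ ψ →
  IsPIso X φ ψ × (∀ x → B (φ x) ≡ A x) × RankableIn X B

-- A has exactly one word of each length, so its census is the constant 1.
-- A is built in stages.  Stage s takes a fresh length n and attacks every
-- triple (φ-machine, ψ-machine, rank-machine) with at most s states, run
-- for s (m + 1) ^ s + s steps on inputs of length m, using the oracle
-- X = "A so far, with nothing of length n": it computes the images D of the
-- known words of A, locates φ w by a binary search comparing the rank
-- machine with the rank of D, and applies ψ.  These simulations ask
-- polynomially many questions, so some w of length n is asked by none of
-- them; putting w into A makes every simulation faithful, and a triple
-- scaling A would then have asked for w itself.
module Submission where

open import Data.Bool using (Bool; true; false; _∧_; _∨_; if_then_else_)
import Data.Bool as Bool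
open import Data.Bool.Properties using (∧-distribʳ-∨; ∧-zeroʳ; ∧-identityʳ; ¬-not)
open import Data.Empty using (⊥; ⊥-elim)
open import Data.Fin using (Fin; zero; suc)
open import Data.Fin.Properties using (2↔Bool)
open import Data.List
  using (List; []; _∷_; [_]; length; map; _++_; _∷ʳ_; foldl; concatMap; filter; replicate; upTo; allFin;
         cartesianProductWith; cartesianProduct)
open import Data.List.Extrema.Nat using (argmax; f[xs]≤f[argmax])
open import Data.List.Membership.Propositional using (_∈_; _∉_; find)
open import Data.List.Membership.Propositional.Properties
  using (∈-map⁺; ∈-map⁻; ∈-allFin; ∈-upTo⁺; ∈-upTo⁻; ∈-cartesianProductWith⁺;
         ∈-filter⁺; ∈-filter⁻; ∈-++⁺ˡ; ∈-++⁺ʳ; ∈-concatMap⁺)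
open import Data.List.Properties
  using (length-map; length-++; length-replicate; length-filter; length-upTo; foldl-++; ++-assoc; ++-identityʳ;
         ≡-dec; upTo-∷ʳ; concatMap-++)
open import Data.List.Relation.Unary.All using (All; []; _∷_)
import Data.List.Relation.Unary.All as All
import Data.List.Relation.Unary.All.Properties as All
open import Data.List.Relation.Unary.Any using (Any; here; there)
import Data.List.Relation.Unary.Any as Any
import Data.List.Relation.Unary.Any.Properties as Any
open import Data.Maybe using (just; fromMaybe)
open import Data.Nat
  using (ℕ; zero; suc; pred; _+_; _*_; _^_; _≤_; _<_; _≤′_; ≤′-refl; ≤′-step; _≤ᵇ_; _<ᵇ_; _≡ᵇ_;
         z≤n; s≤s; s≤s⁻¹; s<s⁻¹)
open import Data.Nat.Binary.Base as ℕᵇ using (ℕᵇ; 2[1+_]; 1+[2_])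
open import Data.Nat.Binary.Properties using (toℕ-fromℕ; fromℕ-toℕ)
open import Data.Nat.Properties
open import Data.Nat.Tactic.RingSolver using (solve-∀)
open import Data.Product using (Σ; _×_; _,_; proj₁; proj₂)
open import Data.Sum using (_⊎_; inj₁; inj₂)
import Data.Vec.Functional as Vector
open import Function using (_∘_; _$_; Inverse; _↔_; mk↔ₛ′)
open import Function.Bundles using (mk⇔)
open import Function.Properties.Inverse using (↔-refl)
open import Relation.Binary.Definitions using (tri<; tri≈; tri>)
open import Relation.Binary.PropositionalEquality
  using (_≡_; _≢_; refl; sym; trans; cong; cong₂; subst; subst₂; module ≡-Reasoning)
open import Relation.Nullary using (¬_; Dec; yes; no; does; ¬?; contradiction)
open import Relation.Nullary.Decidable using (dec-true; dec-false; does-⇔)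

open import Defs

module _ (X : Lang) (M : OTM) where
  open OTM M

  mutual
    queriesFor : ℕ → Fin nStates → Tape → Tape → List Word
    queriesFor zero    q w qt = []
    queriesFor (suc t) q w qt =
      queryWord qt ∷ queriesAfter t w qt (δ q (Tape.cur w) (Tape.cur qt) (X (queryWord qt)))

    queriesAfter : ℕ → Tape → Tape → Action nStates → List Word
    queriesAfter t w qt halt              = []
    queriesAfter t w qt (go q' s m s' m') =
      queriesFor t q' (moveTape m (writeTape s w)) (moveTape m' (writeTape s' qt))

  queries : ℕ → Word → List Word
  queries t x = queriesFor t start (inputTape x) emptyTape

runFor-agree : ∀ X Y M t q w qt → All (λ z → X z ≡ Y z) (queriesFor X M t q w qt) →
               runFor X M t q w qt ≡ runFor Y M t q w qt
runFor-agree X Y M zero    q w qt _ = refl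
runFor-agree X Y M (suc t) q w qt (agreeHere ∷ agreeLater)
  with X (queryWord qt) | Y (queryWord qt) | agreeHere
... | a | .a | refl with OTM.δ M q (Tape.cur w) (Tape.cur qt) a
...   | halt            = refl
...   | go q' s m s' m' = runFor-agree X Y M t q' _ _ agreeLater

run-agree : ∀ X Y M t x → All (λ z → X z ≡ Y z) (queries X M t x) → run X M t x ≡ run Y M t x
run-agree X Y M t x = runFor-agree X Y M t _ _ _

length-queriesFor : ∀ X M t q w qt → length (queriesFor X M t q w qt) ≤ t
length-queriesFor X M zero    q w qt = z≤n
length-queriesFor X M (suc t) q w qt
  with OTM.δ M q (Tape.cur w) (Tape.cur qt) (X (queryWord qt))
... | halt            = s≤s z≤n
... | go q' s m s' m' = s≤s (length-queriesFor X M t q' _ _)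

length-queries : ∀ X M t x → length (queries X M t x) ≤ t
length-queries X M t x = length-queriesFor X M t _ _ _

runFor-mono : ∀ X M {t t'} q w qt {y} → t ≤ t' →
              runFor X M t q w qt ≡ just y → runFor X M t' q w qt ≡ just y
runFor-mono X M {suc t} {suc t'} q w qt (s≤s t≤t') halts
  with OTM.δ M q (Tape.cur w) (Tape.cur qt) (X (queryWord qt))
... | halt            = halts
... | go q' s m s' m' = runFor-mono X M q' _ _ t≤t' halts

run-mono : ∀ X M {t t'} x {y} → t ≤ t' → run X M t x ≡ just y → run X M t' x ≡ just y
run-mono X M x = runFor-mono X M _ _ _

runFor-cong-δ : ∀ X M (δ' : Fin (OTM.nStates M) → Sym → Sym → Bool → Action (OTM.nStates M)) →
                (∀ q a b c → OTM.δ M q a b c ≡ δ' q a b c) →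
                ∀ t q w qt → runFor X (record M { δ = δ' }) t q w qt ≡ runFor X M t q w qt
runFor-cong-δ X M δ' δ'≗δ zero    q w qt = refl
runFor-cong-δ X M δ' δ'≗δ (suc t) q w qt
  rewrite sym (δ'≗δ q (Tape.cur w) (Tape.cur qt) (X (queryWord qt)))
  with OTM.δ M q (Tape.cur w) (Tape.cur qt) (X (queryWord qt))
... | halt            = refl
... | go q' s m s' m' = runFor-cong-δ X M δ' δ'≗δ t q' _ _

-- Only the part of the work tape right of the head can end up in the output.
extent : Tape → ℕ
extent (tape l c r) = suc (length r)

length-bitsPrefix : ∀ ss → length (bitsPrefix ss) ≤ length ss
length-bitsPrefix []           = z≤n
length-bitsPrefix (blank ∷ ss) = z≤n
length-bitsPrefix (b0 ∷ ss)    = s≤s (length-bitsPrefix ss)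
length-bitsPrefix (b1 ∷ ss)    = s≤s (length-bitsPrefix ss)

length-tailOf : ∀ (ss : List Sym) → length (tailOf ss) ≤ length ss
length-tailOf []       = z≤n
length-tailOf (s ∷ ss) = n≤1+n _

extent-step : ∀ m s w → extent (moveTape m (writeTape s w)) ≤ suc (extent w)
extent-step left  s (tape []      c r) = n≤1+n _
extent-step left  s (tape (_ ∷ l) c r) = ≤-refl
extent-step right s (tape l       c r) = s≤s (m≤n⇒m≤1+n (length-tailOf r))
extent-step stay  s (tape l       c r) = n≤1+n _

length-outputFor : ∀ X M t q w qt {y} → runFor X M t q w qt ≡ just y → length y ≤ t + extent w
length-outputFor X M (suc t) q w qt halts
  with OTM.δ M q (Tape.cur w) (Tape.cur qt) (X (queryWord qt))
length-outputFor X M (suc t) q (tape l c r) qt refl | halt =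
  m≤n⇒m≤o+n (suc t) (length-bitsPrefix (c ∷ r))
... | go q' s m s' m' = begin
  _                                          ≤⟨ length-outputFor X M t q' _ _ halts ⟩
  t + extent (moveTape m (writeTape s w))    ≤⟨ +-monoʳ-≤ t (extent-step m s w) ⟩
  t + suc (extent w)                         ≡⟨ +-suc t (extent w) ⟩
  suc t + extent w                           ∎
  where open ≤-Reasoning

extent-input : ∀ x → extent (inputTape x) ≤ suc (length x)
extent-input []      = ≤-refl
extent-input (b ∷ x) = s≤s (m≤n⇒m≤1+n (≤-reflexive (length-map toSym x)))

length-output : ∀ X M t x {y} → run X M t x ≡ just y → length y ≤ t + suc (length x)
length-output X M t x halts =
  ≤-trans (length-outputFor X M t _ _ _ halts) (+-monoʳ-≤ t (extent-input x))

-- Enumerating machines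

-- Complete up to _≈_: functions can only be listed up to pointwise equality.
record Enumeration (A : Set) (_≈_ : A → A → Set) : Set where
  field
    elements : List A
    complete : ∀ a → Any (a ≈_) elements
open Enumeration

functions : ∀ {A _≈_} → Enumeration A _≈_ → ∀ n →
            Enumeration (Fin n → A) (λ f g → ∀ i → f i ≈ g i)
functions as zero    = record { elements = [ Vector.[] ] ; complete = λ f → here (λ ()) }
functions as (suc n) = record
  { elements = cartesianProductWith Vector._∷_ (elements as) (elements (functions as n))
  ; complete = λ f → Any.cartesianProductWith⁺ Vector._∷_
                       (λ { a≈ f≈ zero → a≈ ; a≈ f≈ (suc i) → f≈ i })
                       (complete as (f zero)) (complete (functions as n) (f ∘ suc))
  }

functionsOn : ∀ {A _≈_ D k} → Enumeration A _≈_ → Fin k ↔ D →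
              Enumeration (D → A) (λ f g → ∀ d → f d ≈ g d)
functionsOn {A} {_≈_} {k = k} as D↔ = record
  { elements = map (_∘ from) (elements (functions as k))
  ; complete = λ f → Any.map⁺ (Any.map (λ {g} → agree f g) (complete (functions as k) (f ∘ to)))
  }
  where
  open Inverse D↔
  agree : ∀ f g → (∀ i → f (to i) ≈ g i) → ∀ d → f d ≈ g (from d)
  agree f g f∘to≈g d = subst (λ e → f e ≈ g (from d)) (strictlyInverseˡ d) (f∘to≈g (from d))

3↔Sym : Fin 3 ↔ Sym
3↔Sym = mk↔ₛ′ (λ { zero → blank ; (suc zero) → b0 ; (suc (suc zero)) → b1 })
              (λ { blank → zero ; b0 → suc zero ; b1 → suc (suc zero) })
              (λ { blank → refl ; b0 → refl ; b1 → refl })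
              (λ { zero → refl ; (suc zero) → refl ; (suc (suc zero)) → refl })

syms : List Sym
syms = blank ∷ b0 ∷ b1 ∷ []

∈-syms : ∀ s → s ∈ syms
∈-syms blank = here refl
∈-syms b0    = there (here refl)
∈-syms b1    = there (there (here refl))

moves : List Move
moves = left ∷ right ∷ stay ∷ []

∈-moves : ∀ m → m ∈ moves
∈-moves left  = here refl
∈-moves right = there (here refl)
∈-moves stay  = there (there (here refl))

infixl 5 _⊛_
_⊛_ : {A B : Set} → List (A → B) → List A → List B
_⊛_ = cartesianProductWith _$_

∈-⊛ : {A B : Set} {fs : List (A → B)} {xs : List A} {f : A → B} {x : A} →
      f ∈ fs → x ∈ xs → f x ∈ fs ⊛ xs
∈-⊛ = ∈-cartesianProductWith⁺ _$_

actions : ∀ m → Enumeration (Action m) _≡_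
actions m = record
  { elements = halt ∷ (map go (allFin m) ⊛ syms ⊛ moves ⊛ syms ⊛ moves)
  ; complete = λ
      { halt               → here refl
      ; (go q s mv s' mv') → there (∈-⊛ (∈-⊛ (∈-⊛ (∈-⊛ (∈-map⁺ go (∈-allFin q))
                                (∈-syms s)) (∈-moves mv)) (∈-syms s')) (∈-moves mv'))
      }
  }

Transitions : ℕ → Set
Transitions m = Fin m → Sym → Sym → Bool → Action m

transitions : ∀ m → Enumeration (Transitions m) (λ δ δ' → ∀ q a b c → δ q a b c ≡ δ' q a b c)
transitions m = functionsOn (functionsOn (functionsOn (functionsOn (actions m) 2↔Bool) 3↔Sym) 3↔Sym) ↔-refl

machinesWithStates : ℕ → List OTM
machinesWithStates m = cartesianProductWith mkOTM (allFin m) (elements (transitions m))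
  where
  mkOTM : Fin m → Transitions m → OTM
  mkOTM q₀ δ = record { nStates = m ; start = q₀ ; δ = δ }

machines : ℕ → List OTM
machines s = concatMap machinesWithStates (upTo (suc s))

SameRuns : OTM → OTM → Set
SameRuns M M' = ∀ X t x → run X M t x ≡ run X M' t x

machines-complete : ∀ s M → OTM.nStates M ≤ s → Any (SameRuns M) (machines s)
machines-complete s M size≤s =
  Any.concatMap⁺ machinesWithStates (Any.map with-states (∈-upTo⁺ (s≤s size≤s)))
  where
  open OTM M
  same : ∀ {q₀ δ'} → start ≡ q₀ → (∀ q a b c → δ q a b c ≡ δ' q a b c) →
         SameRuns M (record { nStates = nStates ; start = q₀ ; δ = δ' })
  same refl δ≗δ' X t x = sym (runFor-cong-δ X M _ δ≗δ' t _ _ _)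
  with-states : ∀ {m} → nStates ≡ m → Any (SameRuns M) (machinesWithStates m)
  with-states refl = Any.cartesianProductWith⁺ _ same (∈-allFin start) (complete (transitions nStates) δ)

-- Words in the standard order

bit : Bool → ℕ
bit b = if b then 1 else 0

val-step : ℕ → Bool → ℕ
val-step acc b = bit b + 2 * acc

foldl-val-step : ∀ x a → foldl val-step a x ≡ a * 2 ^ length x + val x
foldl-val-step []      a = sym (trans (+-identityʳ (a * 1)) (*-identityʳ a))
foldl-val-step (b ∷ x) a
  rewrite foldl-val-step x (val-step a b) | foldl-val-step x (val-step 0 b) = shift (bit b) a (2 ^ length x) (val x)
  where
  shift : ∀ d a p v → (d + 2 * a) * p + v ≡ a * (2 * p) + ((d + 2 * 0) * p + v)
  shift = solve-∀

val-∷ : ∀ b x → val (b ∷ x) ≡ bit b * 2 ^ length x + val x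
val-∷ b x = trans (foldl-val-step x (val-step 0 b)) (cong (λ d → d * 2 ^ length x + val x) (+-identityʳ (bit b)))

val<2^length : ∀ x → val x < 2 ^ length x
val<2^length []      = s≤s z≤n
val<2^length (b ∷ x) rewrite val-∷ b x = bounded b (val<2^length x)
  where
  bounded : ∀ b {p v} → v < p → bit b * p + v < 2 * p
  bounded false {p} v<p = ≤-trans v<p (m≤m+n p (p + 0))
  bounded true  {p} v<p = subst₂ _<_ (cong (_+ _) (sym (*-identityˡ p))) (cong (p +_) (sym (+-identityʳ p)))
                                   (+-monoʳ-< p v<p)

-- Word x is numbered by the bijective base-2 numeral with digit 1 for
-- false and digit 2 for true; ℕᵇ is exactly that numeral system.
push : ℕᵇ → Bool → ℕᵇ
push n false = 1+[2 n ]
push n true  = 2[1+ n ]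

toℕᵇ : Word → ℕᵇ
toℕᵇ = foldl push ℕᵇ.zero

fromℕᵇ : ℕᵇ → Word
fromℕᵇ ℕᵇ.zero = []
fromℕᵇ 1+[2 n ] = fromℕᵇ n ∷ʳ false
fromℕᵇ 2[1+ n ] = fromℕᵇ n ∷ʳ true

index : Word → ℕ
index x = ℕᵇ.toℕ (toℕᵇ x)

wordAt : ℕ → Word
wordAt j = fromℕᵇ (ℕᵇ.fromℕ j)

toℕᵇ-∷ʳ : ∀ x b → toℕᵇ (x ∷ʳ b) ≡ push (toℕᵇ x) b
toℕᵇ-∷ʳ x b = foldl-++ push ℕᵇ.zero x [ b ]

toℕᵇ-fromℕᵇ : ∀ n → toℕᵇ (fromℕᵇ n) ≡ n
toℕᵇ-fromℕᵇ ℕᵇ.zero = refl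
toℕᵇ-fromℕᵇ 1+[2 n ] = trans (toℕᵇ-∷ʳ (fromℕᵇ n) false) (cong 1+[2_] (toℕᵇ-fromℕᵇ n))
toℕᵇ-fromℕᵇ 2[1+ n ] = trans (toℕᵇ-∷ʳ (fromℕᵇ n) true) (cong 2[1+_] (toℕᵇ-fromℕᵇ n))

fromℕᵇ-foldl : ∀ x n → fromℕᵇ (foldl push n x) ≡ fromℕᵇ n ++ x
fromℕᵇ-foldl []      n = sym (++-identityʳ (fromℕᵇ n))
fromℕᵇ-foldl (b ∷ x) n = trans (fromℕᵇ-foldl x (push n b)) (appended b)
  where
  appended : ∀ b → fromℕᵇ (push n b) ++ x ≡ fromℕᵇ n ++ b ∷ x
  appended false = ++-assoc (fromℕᵇ n) [ false ] x
  appended true  = ++-assoc (fromℕᵇ n) [ true ] x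

index-wordAt : ∀ j → index (wordAt j) ≡ j
index-wordAt j = trans (cong ℕᵇ.toℕ (toℕᵇ-fromℕᵇ (ℕᵇ.fromℕ j))) (toℕ-fromℕ j)

wordAt-index : ∀ x → wordAt (index x) ≡ x
wordAt-index x = trans (cong fromℕᵇ (fromℕ-toℕ (toℕᵇ x))) (fromℕᵇ-foldl x ℕᵇ.zero)

suc-push : ∀ n b → suc (ℕᵇ.toℕ (push n b)) ≡ val-step (suc (ℕᵇ.toℕ n)) b
suc-push n false = arith (ℕᵇ.toℕ n)
  where
  arith : ∀ k → suc (suc (2 * k)) ≡ 0 + 2 * suc k
  arith = solve-∀
suc-push n true = refl

suc-toℕ-foldl : ∀ x n → suc (ℕᵇ.toℕ (foldl push n x)) ≡ foldl val-step (suc (ℕᵇ.toℕ n)) x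
suc-toℕ-foldl []      n = refl
suc-toℕ-foldl (b ∷ x) n = trans (suc-toℕ-foldl x (push n b)) (cong (λ a → foldl val-step a x) (suc-push n b))

suc-index : ∀ x → suc (index x) ≡ 2 ^ length x + val x
suc-index x = trans (suc-toℕ-foldl x ℕᵇ.zero) (trans (foldl-val-step x 1) (cong (_+ val x) (*-identityˡ _)))

suc-index<2^suc-length : ∀ x → suc (index x) < 2 ^ suc (length x)
suc-index<2^suc-length x = begin-strict
  suc (index x)               ≡⟨ suc-index x ⟩
  2 ^ length x + val x        <⟨ +-monoʳ-< (2 ^ length x) (val<2^length x) ⟩
  2 ^ length x + 2 ^ length x ≡⟨ cong (2 ^ length x +_) (sym (+-identityʳ _)) ⟩
  2 ^ suc (length x)          ∎
  where open ≤-Reasoning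

index-<-length : ∀ x y → length x < length y → index x < index y
index-<-length x y |x|<|y| = s<s⁻¹ (begin-strict
  suc (index x)        <⟨ suc-index<2^suc-length x ⟩
  2 ^ suc (length x)   ≤⟨ ^-monoʳ-≤ 2 |x|<|y| ⟩
  2 ^ length y         ≤⟨ m≤m+n _ (val y) ⟩
  2 ^ length y + val y ≡⟨ sym (suc-index y) ⟩
  suc (index y)        ∎)
  where open ≤-Reasoning

index<2^ : ∀ x {P} → length x < P → index x < 2 ^ P
index<2^ x |x|<P = <-≤-trans (n<1+n (index x)) (<⇒≤ (<-≤-trans (suc-index<2^suc-length x) (^-monoʳ-≤ 2 |x|<P)))

length-wordAt : ∀ j {P} → j < 2 ^ P → length (wordAt j) ≤ P
length-wordAt j {P} j<2^P = ≮⇒≥ λ P<|w| → <⇒≱ (^-monoʳ-< 2 (s≤s (s≤s z≤n)) P<|w|) (begin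
  2 ^ length (wordAt j)                      ≤⟨ m≤m+n _ _ ⟩
  2 ^ length (wordAt j) + val (wordAt j)     ≡⟨ sym (suc-index (wordAt j)) ⟩
  suc (index (wordAt j))                     ≡⟨ cong suc (index-wordAt j) ⟩
  suc j                                      ≤⟨ j<2^P ⟩
  2 ^ P                                      ∎)
  where open ≤-Reasoning

+-cancelˡ-≤ᵇ : ∀ k m n → (k + m ≤ᵇ k + n) ≡ (m ≤ᵇ n)
+-cancelˡ-≤ᵇ k m n = does-⇔ (mk⇔ (+-cancelˡ-≤ k m n) (+-monoʳ-≤ k)) (k + m ≤? k + n) (m ≤? n)

val-∷-≤ᵇ : ∀ b x y → length x ≡ length y → (val (b ∷ x) ≤ᵇ val (b ∷ y)) ≡ (val x ≤ᵇ val y)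
val-∷-≤ᵇ b x y |x|≡|y| rewrite val-∷ b x | val-∷ b y | |x|≡|y| =
  +-cancelˡ-≤ᵇ (bit b * 2 ^ length y) (val x) (val y)

val-false<val-true : ∀ x y → length x ≡ length y → val (false ∷ x) < val (true ∷ y)
val-false<val-true x y |x|≡|y| = begin-strict
  val (false ∷ x)      ≡⟨ val-∷ false x ⟩
  val x                <⟨ val<2^length x ⟩
  2 ^ length x         ≡⟨ cong (2 ^_) |x|≡|y| ⟩
  2 ^ length y         ≤⟨ m≤m+n _ (val y) ⟩
  2 ^ length y + val y ≡⟨ sym (trans (val-∷ true y) (cong (_+ val y) (*-identityˡ _))) ⟩
  val (true ∷ y)       ∎
  where open ≤-Reasoning

lex≤-val : ∀ x y → length x ≡ length y → lex≤ x y ≡ (val x ≤ᵇ val y)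
lex≤-val []          []          _       = refl
lex≤-val (false ∷ x) (true ∷ y)  |x|≡|y| =
  sym (dec-true (_ ≤? _) (<⇒≤ (val-false<val-true x y (suc-injective |x|≡|y|))))
lex≤-val (true ∷ x)  (false ∷ y) |x|≡|y| =
  sym (dec-false (_ ≤? _) (<⇒≱ (val-false<val-true y x (suc-injective (sym |x|≡|y|)))))
lex≤-val (false ∷ x) (false ∷ y) |x|≡|y| =
  trans (lex≤-val x y (suc-injective |x|≡|y|)) (sym (val-∷-≤ᵇ false x y (suc-injective |x|≡|y|)))
lex≤-val (true ∷ x)  (true ∷ y)  |x|≡|y| =
  trans (lex≤-val x y (suc-injective |x|≡|y|)) (sym (val-∷-≤ᵇ true x y (suc-injective |x|≡|y|)))

≤std-index : ∀ x y → (x ≤std y) ≡ (index x ≤ᵇ index y)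
≤std-index x y with length x ≟ length y
... | yes |x|≡|y| =
  trans (lex≤-val x y |x|≡|y|) (does-⇔ (mk⇔ val≤⇒index≤ index≤⇒val≤) (_ ≤? _) (_ ≤? _))
  where
  suc-index′ : ∀ z → length z ≡ length x → suc (index z) ≡ 2 ^ length x + val z
  suc-index′ z |z|≡|x| = trans (suc-index z) (cong (λ l → 2 ^ l + val z) |z|≡|x|)
  val≤⇒index≤ : val x ≤ val y → index x ≤ index y
  val≤⇒index≤ v≤ = s≤s⁻¹ (subst₂ _≤_ (sym (suc-index′ x refl)) (sym (suc-index′ y (sym |x|≡|y|)))
                                   (+-monoʳ-≤ (2 ^ length x) v≤))
  index≤⇒val≤ : index x ≤ index y → val x ≤ val y
  index≤⇒val≤ i≤ = +-cancelˡ-≤ (2 ^ length x) _ _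
                     (subst₂ _≤_ (suc-index′ x refl) (suc-index′ y (sym |x|≡|y|)) (s≤s i≤))
... | no  |x|≢|y| = does-⇔ (mk⇔ (λ lt → <⇒≤ (index-<-length x y lt)) index≤⇒length<) (_ <? _) (_ ≤? _)
  where
  index≤⇒length< : index x ≤ index y → length x < length y
  index≤⇒length< i≤ with <-cmp (length x) (length y)
  ... | tri< lt _ _ = lt
  ... | tri≈ _ eq _ = ⊥-elim (|x|≢|y| eq)
  ... | tri> _ _ gt = ⊥-elim (<⇒≱ (index-<-length y x gt) i≤)

-- Counting, census and rank

infix 4 _≟ʷ_
_≟ʷ_ : (x y : Word) → Dec (x ≡ y)
_≟ʷ_ = ≡-dec Bool._≟_

open import Data.List.Membership.DecPropositional _≟ʷ_ using () renaming (_∈?_ to _∈ʷ?_)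

countᵇ-++ : ∀ p xs ys → countᵇ p (xs ++ ys) ≡ countᵇ p xs + countᵇ p ys
countᵇ-++ p []       ys = refl
countᵇ-++ p (x ∷ xs) ys with p x
... | true  = cong suc (countᵇ-++ p xs ys)
... | false = countᵇ-++ p xs ys

countᵇ-map : ∀ p f xs → countᵇ p (map f xs) ≡ countᵇ (p ∘ f) xs
countᵇ-map p f []       = refl
countᵇ-map p f (x ∷ xs) with p (f x)
... | true  = cong suc (countᵇ-map p f xs)
... | false = countᵇ-map p f xs

countᵇ-cong : ∀ {p q} xs → All (λ z → p z ≡ q z) xs → countᵇ p xs ≡ countᵇ q xs
countᵇ-cong {p} {q} []       []           = refl
countᵇ-cong {p} {q} (x ∷ xs) (px≡qx ∷ eq) with p x | q x | px≡qx
... | true  | .true  | refl = cong suc (countᵇ-cong xs eq)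
... | false | .false | refl = countᵇ-cong xs eq

countᵇ-false : ∀ xs → countᵇ (λ _ → false) xs ≡ 0
countᵇ-false []       = refl
countᵇ-false (x ∷ xs) = countᵇ-false xs

countᵇ-∨ : ∀ p q xs → All (λ z → (p z ∧ q z) ≡ false) xs →
           countᵇ (λ z → p z ∨ q z) xs ≡ countᵇ p xs + countᵇ q xs
countᵇ-∨ p q []       []                = refl
countᵇ-∨ p q (x ∷ xs) (disjoint ∷ rest) with p x | q x
... | true  | false = cong suc (countᵇ-∨ p q xs rest)
... | false | true  = trans (cong suc (countᵇ-∨ p q xs rest)) (sym (+-suc _ _))
... | false | false = countᵇ-∨ p q xs rest

countᵇ-∧-const : ∀ p c xs → countᵇ (λ z → p z ∧ c) xs ≡ (if c then countᵇ p xs else 0)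
countᵇ-∧-const p true  xs = countᵇ-cong xs (All.tabulate λ {z} _ → ∧-identityʳ (p z))
countᵇ-∧-const p false xs = trans (countᵇ-cong xs (All.tabulate λ {z} _ → ∧-zeroʳ (p z))) (countᵇ-false xs)

length-wordsOfLength : ∀ n → All (λ z → length z ≡ n) (wordsOfLength n)
length-wordsOfLength zero    = refl ∷ []
length-wordsOfLength (suc n) = All.++⁺ (All.map⁺ (All.map (cong suc) (length-wordsOfLength n)))
                                       (All.map⁺ (All.map (cong suc) (length-wordsOfLength n)))

length-wordsUpTo : ∀ m → All (λ z → length z ≤ m) (wordsUpTo m)
length-wordsUpTo m = All.concat⁺ (All.map⁺ (All.tabulate λ {k} k∈ →
  All.map (λ |z|≡k → ≤-trans (≤-reflexive |z|≡k) (s≤s⁻¹ (∈-upTo⁻ k∈))) (length-wordsOfLength k)))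

All-wordsUpTo : ∀ {P : Word → Set} m → (∀ z → length z ≤ m → P z) → All P (wordsUpTo m)
All-wordsUpTo m P-short = All.map (λ {z} → P-short z) (length-wordsUpTo m)

count-wordsOfLength : ∀ w n → countᵇ (λ z → does (w ≟ʷ z)) (wordsOfLength n) ≡ bit (length w ≡ᵇ n)
count-wordsOfLength []      zero    = refl
count-wordsOfLength (b ∷ w) zero    = refl
count-wordsOfLength w       (suc n) = begin
  countᵇ P (map (false ∷_) W ++ map (true ∷_) W)
    ≡⟨ countᵇ-++ P (map (false ∷_) W) _ ⟩
  countᵇ P (map (false ∷_) W) + countᵇ P (map (true ∷_) W)
    ≡⟨ cong₂ _+_ (countᵇ-map P _ W) (countᵇ-map P _ W) ⟩
  countᵇ (P ∘ (false ∷_)) W + countᵇ (P ∘ (true ∷_)) W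
    ≡⟨ by-head w ⟩
  bit (length w ≡ᵇ suc n) ∎
  where
  open ≡-Reasoning
  W : List Word
  W = wordsOfLength n
  P : Word → Bool
  P z = does (w ≟ʷ z)
  by-head : ∀ w → countᵇ (λ z → does (w ≟ʷ false ∷ z)) W + countᵇ (λ z → does (w ≟ʷ true ∷ z)) W
                  ≡ bit (length w ≡ᵇ suc n)
  by-head []           = cong₂ _+_ (countᵇ-false W) (countᵇ-false W)
  by-head (false ∷ w') = trans (cong₂ _+_ (count-wordsOfLength w' n) (countᵇ-false W)) (+-identityʳ _)
  by-head (true ∷ w')  = cong₂ _+_ (countᵇ-false W) (count-wordsOfLength w' n)

bit-<ᵇ-suc : ∀ l k → bit (l <ᵇ k) + bit (l ≡ᵇ k) ≡ bit (l <ᵇ suc k)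
bit-<ᵇ-suc zero    zero    = refl
bit-<ᵇ-suc zero    (suc k) = refl
bit-<ᵇ-suc (suc l) zero    = refl
bit-<ᵇ-suc (suc l) (suc k) = bit-<ᵇ-suc l k

count-wordsBelow : ∀ w k →
                   countᵇ (λ z → does (w ≟ʷ z)) (concatMap wordsOfLength (upTo k)) ≡ bit (length w <ᵇ k)
count-wordsBelow w zero    = refl
count-wordsBelow w (suc k) = begin
  countᵇ P (concatMap wordsOfLength (upTo (suc k)))
    ≡⟨ cong (λ ks → countᵇ P (concatMap wordsOfLength ks)) (sym (upTo-∷ʳ k)) ⟩
  countᵇ P (concatMap wordsOfLength (upTo k ∷ʳ k))
    ≡⟨ cong (countᵇ P) (concatMap-++ wordsOfLength (upTo k) [ k ]) ⟩
  countᵇ P (concatMap wordsOfLength (upTo k) ++ (wordsOfLength k ++ []))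
    ≡⟨ countᵇ-++ P (concatMap wordsOfLength (upTo k)) _ ⟩
  countᵇ P (concatMap wordsOfLength (upTo k)) + countᵇ P (wordsOfLength k ++ [])
    ≡⟨ cong (countᵇ P (concatMap wordsOfLength (upTo k)) +_) (countᵇ-++ P (wordsOfLength k) []) ⟩
  countᵇ P (concatMap wordsOfLength (upTo k)) + (countᵇ P (wordsOfLength k) + 0)
    ≡⟨ cong₂ _+_ (count-wordsBelow w k) (trans (+-identityʳ _) (count-wordsOfLength w k)) ⟩
  bit (length w <ᵇ k) + bit (length w ≡ᵇ k)
    ≡⟨ bit-<ᵇ-suc (length w) k ⟩
  bit (length w <ᵇ suc k) ∎
  where
  open ≡-Reasoning
  P : Word → Bool
  P z = does (w ≟ʷ z)

count-wordsUpTo : ∀ w m → length w ≤ m → countᵇ (λ z → does (w ≟ʷ z)) (wordsUpTo m) ≡ 1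
count-wordsUpTo w m |w|≤m = trans (count-wordsBelow w (suc m)) (cong bit (dec-true (_ <? _) (s≤s |w|≤m)))

singletons : (ℕ → Word) → Lang
singletons f z = does (f (length z) ≟ʷ z)

census-singletons : ∀ f n → length (f n) ≡ n → census (singletons f) n ≡ 1
census-singletons f n |fn|≡n = begin
  countᵇ (singletons f) (wordsOfLength n)
    ≡⟨ countᵇ-cong (wordsOfLength n)
         (All.map (λ {z} |z|≡n → cong (λ l → does (f l ≟ʷ z)) |z|≡n) (length-wordsOfLength n)) ⟩
  countᵇ (λ z → does (f n ≟ʷ z)) (wordsOfLength n)
    ≡⟨ count-wordsOfLength (f n) n ⟩
  bit (length (f n) ≡ᵇ n)
    ≡⟨ cong bit (dec-true (_ ≟ _) |fn|≡n) ⟩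
  1 ∎
  where open ≡-Reasoning

≤std⇒length≤ : ∀ x y → (x ≤std y) ≡ true → length x ≤ length y
≤std⇒length≤ x y x≤y with length x ≟ length y
... | yes |x|≡|y| = ≤-reflexive |x|≡|y|
... | no  _       = <⇒≤ (<ᵇ⇒< _ _ (subst Bool.T (sym x≤y) _))

rank-∪-singleton : ∀ S D b y → (∀ z → length z ≤ length y → S z ≡ (D z ∨ does (b ≟ʷ z))) →
                   D b ≡ false → rank S y ≡ rank D y + bit (b ≤std y)
rank-∪-singleton S D b y S≡D∪b b∉D = begin
  countᵇ (λ z → S z ∧ (z ≤std y)) W
    ≡⟨ countᵇ-cong W (All-wordsUpTo (length y) λ z short →
         trans (cong (_∧ (z ≤std y)) (S≡D∪b z short)) (∧-distribʳ-∨ (z ≤std y) (D z) (does (b ≟ʷ z)))) ⟩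
  countᵇ (λ z → (D z ∧ (z ≤std y)) ∨ (does (b ≟ʷ z) ∧ (z ≤std y))) W
    ≡⟨ countᵇ-∨ (λ z → D z ∧ (z ≤std y)) (λ z → does (b ≟ʷ z) ∧ (z ≤std y)) W
         (All.tabulate λ {z} _ → disjoint z) ⟩
  rank D y + countᵇ (λ z → does (b ≟ʷ z) ∧ (z ≤std y)) W
    ≡⟨ cong (rank D y +_) (countᵇ-cong W (All.tabulate λ {z} _ → only-b z)) ⟩
  rank D y + countᵇ (λ z → does (b ≟ʷ z) ∧ (b ≤std y)) W
    ≡⟨ cong (rank D y +_) (countᵇ-∧-const (λ z → does (b ≟ʷ z)) (b ≤std y) W) ⟩
  rank D y + (if b ≤std y then countᵇ (λ z → does (b ≟ʷ z)) W else 0)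
    ≡⟨ cong (rank D y +_) count-b ⟩
  rank D y + bit (b ≤std y) ∎
  where
  open ≡-Reasoning
  W : List Word
  W = wordsUpTo (length y)
  disjoint : ∀ z → ((D z ∧ (z ≤std y)) ∧ (does (b ≟ʷ z) ∧ (z ≤std y))) ≡ false
  disjoint z with b ≟ʷ z
  ... | yes refl rewrite b∉D = refl
  ... | no  _    = ∧-zeroʳ _
  only-b : ∀ z → (does (b ≟ʷ z) ∧ (z ≤std y)) ≡ (does (b ≟ʷ z) ∧ (b ≤std y))
  only-b z with b ≟ʷ z
  ... | yes refl = refl
  ... | no  _    = refl
  count-b : (if b ≤std y then countᵇ (λ z → does (b ≟ʷ z)) W else 0) ≡ bit (b ≤std y)
  count-b with b ≤std y in b≤y
  ... | true  = count-wordsUpTo b (length y) (≤std⇒length≤ b y b≤y)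
  ... | false = refl

-- Fresh words

tailsAfter : Bool → List Word → List Word
tailsAfter c []            = []
tailsAfter c ([] ∷ Q)      = tailsAfter c Q
tailsAfter c ((d ∷ z) ∷ Q) = if does (c Bool.≟ d) then z ∷ tailsAfter c Q else tailsAfter c Q

length-tailsAfter : ∀ Q → length (tailsAfter false Q) + length (tailsAfter true Q) ≤ length Q
length-tailsAfter []               = z≤n
length-tailsAfter ([] ∷ Q)         = m≤n⇒m≤1+n (length-tailsAfter Q)
length-tailsAfter ((false ∷ z) ∷ Q) = s≤s (length-tailsAfter Q)
length-tailsAfter ((true ∷ z) ∷ Q)  = subst (_≤ suc (length Q)) (sym (+-suc _ _)) (s≤s (length-tailsAfter Q))

∈-tailsAfter : ∀ c z Q → (c ∷ z) ∈ Q → z ∈ tailsAfter c Q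
∈-tailsAfter false z (_ ∷ Q)       (here refl) = here refl
∈-tailsAfter true  z (_ ∷ Q)       (here refl) = here refl
∈-tailsAfter c     z ([] ∷ Q)      (there c∷z∈Q) = ∈-tailsAfter c z Q c∷z∈Q
∈-tailsAfter c     z ((d ∷ _) ∷ Q) (there c∷z∈Q) with does (c Bool.≟ d)
... | true  = there (∈-tailsAfter c z Q c∷z∈Q)
... | false = ∈-tailsAfter c z Q c∷z∈Q

-- At each position take the bit under which fewer words of Q continue.
freshWord : ℕ → List Word → Word
freshWord zero    Q = []
freshWord (suc n) Q =
  if length (tailsAfter false Q) <ᵇ 2 ^ n then false ∷ freshWord n (tailsAfter false Q)
                                          else true ∷ freshWord n (tailsAfter true Q)

length-freshWord : ∀ n Q → length (freshWord n Q) ≡ n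
length-freshWord zero    Q = refl
length-freshWord (suc n) Q with length (tailsAfter false Q) <ᵇ 2 ^ n
... | true  = cong suc (length-freshWord n _)
... | false = cong suc (length-freshWord n _)

freshWord∉ : ∀ n Q → length Q < 2 ^ n → ¬ (freshWord n Q ∈ Q)
freshWord∉ zero    []      _        ()
freshWord∉ zero    (_ ∷ Q) (s≤s ())
freshWord∉ (suc n) Q       |Q|<2^1+n with length (tailsAfter false Q) <ᵇ 2 ^ n in few
... | true  = freshWord∉ n _ (<ᵇ⇒< _ _ (subst Bool.T (sym few) _)) ∘ ∈-tailsAfter false _ Q
... | false = freshWord∉ n _ (+-cancelˡ-< (2 ^ n) _ _ (begin-strict
  2 ^ n + length (tailsAfter true Q)                                ≤⟨ +-monoˡ-≤ _ many ⟩
  length (tailsAfter false Q) + length (tailsAfter true Q)          ≤⟨ length-tailsAfter Q ⟩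
  length Q                                                          <⟨ |Q|<2^1+n ⟩
  2 ^ suc n                                                         ≡⟨ cong (2 ^ n +_) (+-identityʳ _) ⟩
  2 ^ n + 2 ^ n                                                     ∎)) ∘ ∈-tailsAfter true _ Q
  where
  open ≤-Reasoning
  many : 2 ^ n ≤ length (tailsAfter false Q)
  many = ≮⇒≥ λ lt → subst Bool.T few (<⇒<ᵇ lt)

-- Binary search

≤ᵇ-true : ∀ {m n} → true ≡ (m ≤ᵇ n) → m ≤ n
≤ᵇ-true {m} {n} t = ≤ᵇ⇒≤ m n (subst Bool.T t _)

≤ᵇ-false : ∀ {m n} → false ≡ (m ≤ᵇ n) → n < m
≤ᵇ-false f = ≰⇒> λ m≤n → subst Bool.T (sym f) (≤⇒≤ᵇ m≤n)

bisect : (ℕ → Bool) → ℕ → ℕ → ℕ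
bisect p lo zero    = if p lo then lo else suc lo
bisect p lo (suc d) = if p (lo + 2 ^ d) then bisect p lo d else bisect p (lo + 2 ^ d) d

probes : (ℕ → Bool) → ℕ → ℕ → List ℕ
probes p lo zero    = [ lo ]
probes p lo (suc d) = (lo + 2 ^ d) ∷ (if p (lo + 2 ^ d) then probes p lo d else probes p (lo + 2 ^ d) d)

2^suc : ∀ lo d → lo + 2 ^ d + 2 ^ d ≡ lo + 2 ^ suc d
2^suc lo d = trans (+-assoc lo _ _) (cong (λ e → lo + (2 ^ d + e)) (sym (+-identityʳ _)))

mid<hi : ∀ lo d → lo + 2 ^ d < lo + 2 ^ suc d
mid<hi lo d = +-monoʳ-< lo (^-monoʳ-< 2 (s≤s (s≤s z≤n)) (n<1+n d))

bisect-threshold : ∀ p k lo d → lo ≤ k → k ≤ lo + 2 ^ d →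
                   All (λ j → p j ≡ (k ≤ᵇ j)) (probes p lo d) → bisect p lo d ≡ k
bisect-threshold p k lo zero lo≤k k≤lo+1 (p-lo ∷ []) with p lo
... | true  = ≤-antisym lo≤k (≤ᵇ-true p-lo)
... | false = ≤-antisym (≤ᵇ-false p-lo) (subst (k ≤_) (+-comm lo 1) k≤lo+1)
bisect-threshold p k lo (suc d) lo≤k k≤hi (p-mid ∷ rest) with p (lo + 2 ^ d)
... | true  = bisect-threshold p k lo d lo≤k (≤ᵇ-true p-mid) rest
... | false =
  bisect-threshold p k (lo + 2 ^ d) d (<⇒≤ (≤ᵇ-false p-mid)) (subst (k ≤_) (sym (2^suc lo d)) k≤hi) rest

bisect≤ : ∀ p lo d → bisect p lo d ≤ lo + 2 ^ d
bisect≤ p lo zero with p lo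
... | true  = m≤m+n lo 1
... | false = ≤-reflexive (+-comm 1 lo)
bisect≤ p lo (suc d) with p (lo + 2 ^ d)
... | true  = ≤-trans (bisect≤ p lo d) (<⇒≤ (mid<hi lo d))
... | false = ≤-trans (bisect≤ p (lo + 2 ^ d) d) (≤-reflexive (2^suc lo d))

length-probes : ∀ p lo d → length (probes p lo d) ≡ suc d
length-probes p lo zero    = refl
length-probes p lo (suc d) with p (lo + 2 ^ d)
... | true  = cong suc (length-probes p lo d)
... | false = cong suc (length-probes p (lo + 2 ^ d) d)

probes< : ∀ p lo d → All (_< lo + 2 ^ d) (probes p lo d)
probes< p lo zero    = subst (lo <_) (+-comm 1 lo) (n<1+n lo) ∷ []
probes< p lo (suc d) with p (lo + 2 ^ d)
... | true  = mid<hi lo d ∷ All.map (λ j< → <-trans j< (mid<hi lo d)) (probes< p lo d)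
... | false = mid<hi lo d ∷ All.map (λ {j} j< → subst (j <_) (2^suc lo d) j<) (probes< p (lo + 2 ^ d) d)

-- Polynomially bounded functions

PolyBounded : (ℕ → ℕ) → Set
PolyBounded f = Σ ℕ λ C → Σ ℕ λ E → ∀ m → f m ≤ C * suc m ^ E

poly-const : ∀ c → PolyBounded (λ _ → c)
poly-const c = c , 0 , λ m → ≤-reflexive (sym (*-identityʳ c))

poly-suc : PolyBounded suc
poly-suc = 1 , 1 , λ m → ≤-reflexive (sym (trans (*-identityˡ _) (*-identityʳ _)))

poly-+ : ∀ {f g} → PolyBounded f → PolyBounded g → PolyBounded (λ m → f m + g m)
poly-+ {f} {g} (C , E , f≤) (D , F , g≤) = C + D , E + F , λ m → begin
  f m + g m                               ≤⟨ +-mono-≤ (f≤ m) (g≤ m) ⟩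
  C * suc m ^ E + D * suc m ^ F           ≤⟨ +-mono-≤ (*-monoʳ-≤ C (^-monoʳ-≤ (suc m) (m≤m+n E F)))
                                                      (*-monoʳ-≤ D (^-monoʳ-≤ (suc m) (m≤n+m F E))) ⟩
  C * suc m ^ (E + F) + D * suc m ^ (E + F) ≡⟨ sym (*-distribʳ-+ (suc m ^ (E + F)) C D) ⟩
  (C + D) * suc m ^ (E + F)               ∎
  where open ≤-Reasoning

poly-* : ∀ {f g} → PolyBounded f → PolyBounded g → PolyBounded (λ m → f m * g m)
poly-* {f} {g} (C , E , f≤) (D , F , g≤) = C * D , E + F , λ m → begin
  f m * g m                               ≤⟨ *-mono-≤ (f≤ m) (g≤ m) ⟩
  (C * suc m ^ E) * (D * suc m ^ F)       ≡⟨ regroup C D (suc m ^ E) (suc m ^ F) ⟩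
  (C * D) * (suc m ^ E * suc m ^ F)       ≡⟨ cong ((C * D) *_) (sym (^-distribˡ-+-* (suc m) E F)) ⟩
  (C * D) * suc m ^ (E + F)               ∎
  where
  open ≤-Reasoning
  regroup : ∀ a b c d → (a * c) * (b * d) ≡ (a * b) * (c * d)
  regroup = solve-∀

^-distribʳ-* : ∀ a b e → (a * b) ^ e ≡ a ^ e * b ^ e
^-distribʳ-* a b zero    = refl
^-distribʳ-* a b (suc e) = trans (cong ((a * b) *_) (^-distribʳ-* a b e)) (regroup a b (a ^ e) (b ^ e))
  where
  regroup : ∀ a b c d → (a * b) * (c * d) ≡ (a * c) * (b * d)
  regroup = solve-∀

poly-∘ : ∀ {f g} → PolyBounded f → PolyBounded g → PolyBounded (λ m → f (g m))
poly-∘ {f} {g} (C , E , f≤) (D , F , g≤) = C * suc D ^ E , F * E , λ m → begin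
  f (g m)                                 ≤⟨ f≤ (g m) ⟩
  C * suc (g m) ^ E                       ≤⟨ *-monoʳ-≤ C (^-monoˡ-≤ E (suc-g≤ m)) ⟩
  C * (suc D * suc m ^ F) ^ E             ≡⟨ cong (C *_) (^-distribʳ-* (suc D) (suc m ^ F) E) ⟩
  C * (suc D ^ E * (suc m ^ F) ^ E)       ≡⟨ cong (λ e → C * (suc D ^ E * e)) (^-*-assoc (suc m) F E) ⟩
  C * (suc D ^ E * suc m ^ (F * E))       ≡⟨ sym (*-assoc C _ _) ⟩
  C * suc D ^ E * suc m ^ (F * E)         ∎
  where
  open ≤-Reasoning
  suc-g≤ : ∀ m → suc (g m) ≤ suc D * suc m ^ F
  suc-g≤ m = ≤-trans (s≤s (g≤ m)) (+-monoˡ-≤ (D * suc m ^ F) (m^n>0 (suc m) F))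

n<2^n : ∀ n → n < 2 ^ n
n<2^n zero    = s≤s z≤n
n<2^n (suc n) = begin-strict
  suc n         ≤⟨ n<2^n n ⟩
  2 ^ n         <⟨ m<m+n (2 ^ n) (m^n>0 2 n) ⟩
  2 ^ n + 2 ^ n ≡⟨ cong (2 ^ n +_) (sym (+-identityʳ _)) ⟩
  2 ^ suc n     ∎
  where open ≤-Reasoning

square≤2^ : ∀ k → (4 + k) * (4 + k) ≤ 2 ^ (4 + k)
square≤2^ zero    = ≤-refl
square≤2^ (suc k) = begin
  (5 + k) * (5 + k)                         ≡⟨ expand k ⟩
  (4 + k) * (4 + k) + (9 + 2 * k)           ≤⟨ +-monoʳ-≤ ((4 + k) * (4 + k)) 9+2k≤square ⟩
  (4 + k) * (4 + k) + (4 + k) * (4 + k)     ≤⟨ +-mono-≤ (square≤2^ k) (square≤2^ k) ⟩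
  2 ^ (4 + k) + 2 ^ (4 + k)                 ≡⟨ cong (2 ^ (4 + k) +_) (sym (+-identityʳ _)) ⟩
  2 ^ (5 + k)                               ∎
  where
  open ≤-Reasoning
  expand : ∀ k → (5 + k) * (5 + k) ≡ (4 + k) * (4 + k) + (9 + 2 * k)
  expand = solve-∀
  regroup : ∀ k → 9 + 2 * k + (7 + k * k + 6 * k) ≡ (4 + k) * (4 + k)
  regroup = solve-∀
  9+2k≤square : 9 + 2 * k ≤ (4 + k) * (4 + k)
  9+2k≤square = ≤-trans (m≤m+n (9 + 2 * k) (7 + k * k + 6 * k)) (≤-reflexive (regroup k))

-- For f m ≤ C * suc m ^ E: with n = 2 ^ j ∸ 1, suc n ^ E is a power of two,
-- and j is chosen so that C + j * E < j * j ≤ 2 ^ j.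
module Crossover (C E b : ℕ) where

  j n : ℕ
  j = 4 + (C + E + b)
  n = pred (2 ^ j)

  suc-n : suc n ≡ 2 ^ j
  suc-n = suc-pred (2 ^ j) {{m^n≢0 2 j}}

  b≤n : b ≤ n
  b≤n = s≤s⁻¹ (begin
    suc b   ≤⟨ s≤s (≤-trans (m≤n+m b (C + E)) (m≤n+m _ 3)) ⟩
    j       <⟨ n<2^n j ⟩
    2 ^ j   ≡⟨ sym suc-n ⟩
    suc n   ∎)
    where open ≤-Reasoning

  C+j*E≤n : C + j * E ≤ n
  C+j*E≤n = s≤s⁻¹ (begin-strict
    C + j * E                 <⟨ +-monoˡ-< (j * E) C<j ⟩
    j + j * E                 ≤⟨ +-monoˡ-≤ (j * E) (m≤m*n j (4 + (C + b))) ⟩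
    j * (4 + (C + b)) + j * E ≡⟨ square C E b ⟩
    j * j                     ≤⟨ square≤2^ (C + E + b) ⟩
    2 ^ j                     ≡⟨ sym suc-n ⟩
    suc n                     ∎)
    where
    open ≤-Reasoning
    C<j : C < j
    C<j = s≤s (≤-trans (m≤m+n C (E + b)) (≤-trans (≤-reflexive (sym (+-assoc C E b))) (m≤n+m _ 3)))
    square : ∀ C E b → (4 + (C + E + b)) * (4 + (C + b)) + (4 + (C + E + b)) * E
                       ≡ (4 + (C + E + b)) * (4 + (C + E + b))
    square = solve-∀

-- Only crossover-≥ and crossover-< matter; opacity keeps the type checker
-- from unfolding the astronomically large numeral.
opaque
  crossover : ∀ {f} → PolyBounded f → ℕ → ℕ
  crossover (C , E , _) b = Crossover.n C E b

  crossover-≥ : ∀ {f} (f-poly : PolyBounded f) b → b ≤ crossover f-poly b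
  crossover-≥ (C , E , _) b = Crossover.b≤n C E b

  crossover-< : ∀ {f} (f-poly : PolyBounded f) b → f (crossover f-poly b) < 2 ^ crossover f-poly b
  crossover-< {f} (C , E , f≤) b = begin-strict
    f n                 ≤⟨ f≤ n ⟩
    C * suc n ^ E       ≡⟨ cong (λ m → C * m ^ E) suc-n ⟩
    C * (2 ^ j) ^ E     ≡⟨ cong (C *_) (^-*-assoc 2 j E) ⟩
    C * 2 ^ (j * E)     <⟨ *-monoˡ-< (2 ^ (j * E)) {{m^n≢0 2 (j * E)}} (n<2^n C) ⟩
    2 ^ C * 2 ^ (j * E) ≡⟨ sym (^-distribˡ-+-* 2 C (j * E)) ⟩
    2 ^ (C + j * E)     ≤⟨ ^-monoʳ-≤ 2 C+j*E≤n ⟩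
    2 ^ n               ∎
    where
    open ≤-Reasoning
    open Crossover C E b

-- Machines run with a uniform clock

clock : ℕ → ℕ → ℕ
clock s m = s * suc m ^ s + s

clock-≥ : ∀ {c k s} m → c ≤ s → k ≤ s → c * m ^ k + c ≤ clock s m
clock-≥ {c} {k} {s} m c≤s k≤s =
  +-mono-≤ (*-mono-≤ c≤s (≤-trans (^-monoˡ-≤ k (n≤1+n m)) (^-monoʳ-≤ (suc m) k≤s))) c≤s

clock-mono : ∀ s {m m'} → m ≤ m' → clock s m ≤ clock s m'
clock-mono s m≤m' = +-monoˡ-≤ s (*-monoʳ-≤ s (^-monoˡ-≤ s (s≤s m≤m')))

-- The output is [] when M does not halt within the clock.
output : Lang → OTM → ℕ → Word → Word
output X M s x = fromMaybe [] (run X M (clock s (length x)) x)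

asked : Lang → OTM → ℕ → Word → List Word
asked X M s x = queries X M (clock s (length x)) x

output-agree : ∀ X Y M s x → All (λ z → X z ≡ Y z) (asked X M s x) → output X M s x ≡ output Y M s x
output-agree X Y M s x agree = cong (fromMaybe []) (run-agree X Y M _ x agree)

length-asked : ∀ X M s x {m} → length x ≤ m → length (asked X M s x) ≤ clock s m
length-asked X M s x |x|≤m = ≤-trans (length-queries X M _ x) (clock-mono s |x|≤m)

Triple : Set
Triple = OTM × OTM × OTM

triples : ℕ → List Triple
triples s = cartesianProduct (machines s) (cartesianProduct (machines s) (machines s))

record Scaling (A : Lang) (s : ℕ) (Mφ Mψ Mr : OTM) : Set where
  field
    φ ψ        : Word → Word
    B          : Lang
    ψ∘φ        : ∀ x → ψ (φ x) ≡ x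
    φ∘ψ        : ∀ y → φ (ψ y) ≡ y
    B∘φ        : ∀ x → B (φ x) ≡ A x
    computes-φ : ∀ x → run A Mφ (clock s (length x)) x ≡ just (φ x)
    computes-ψ : ∀ y → run A Mψ (clock s (length y)) y ≡ just (ψ y)
    ranks-B    : ∀ y → Σ Word λ o → run A Mr (clock s (length y)) y ≡ just o × val o ≡ rank B y

ScaledBy : Lang → ℕ → Triple → Set
ScaledBy A s (Mφ , Mψ , Mr) = Scaling A s Mφ Mψ Mr

module _ (A : Lang) where

  Reproduces : OTM → ℕ → ℕ → ℕ → OTM → Set
  Reproduces M c k s M' =
    ∀ x {y} → run A M (c * length x ^ k + c) x ≡ just y → run A M' (clock s (length x)) x ≡ just y

  reproduced : ∀ M c k s → OTM.nStates M + c + k ≤ s → Any (Reproduces M c k s) (machines s)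
  reproduced M c k s size≤s = Any.map reproduces (machines-complete s M nStates≤s)
    where
    nStates≤s : OTM.nStates M ≤ s
    nStates≤s = ≤-trans (≤-trans (m≤m+n _ c) (m≤m+n _ k)) size≤s
    reproduces : ∀ {M'} → SameRuns M M' → Reproduces M c k s M'
    reproduces {M'} same x halts = trans (sym (same A (clock s (length x)) x))
      (run-mono A M x (clock-≥ (length x) (≤-trans (≤-trans (m≤n+m c _) (m≤m+n _ k)) size≤s)
                                          (≤-trans (m≤n+m k _) size≤s)) halts)

  scalable⇒scaledBy : Scalable A A → Σ ℕ λ s → Any (ScaledBy A s) (triples s)
  scalable⇒scaledBy
    (B , φ , ψ , (ψ∘φ , φ∘ψ , (Mφ , cφ , kφ , hφ) , (Mψ , cψ , kψ , hψ)) , B∘φ , (Mr , cr , kr , hr)) =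
    s , Any.cartesianProductWith⁺ _,_ scaling (reproduced Mφ cφ kφ s sφ≤s)
          (Any.cartesianProductWith⁺ _,_ _,_ (reproduced Mψ cψ kψ s sψ≤s) (reproduced Mr cr kr s sr≤s))
    where
    sφ sψ sr s : ℕ
    sφ = OTM.nStates Mφ + cφ + kφ
    sψ = OTM.nStates Mψ + cψ + kψ
    sr = OTM.nStates Mr + cr + kr
    s  = sφ + sψ + sr
    sφ≤s : sφ ≤ s
    sφ≤s = ≤-trans (m≤m+n sφ sψ) (m≤m+n _ sr)
    sψ≤s : sψ ≤ s
    sψ≤s = ≤-trans (m≤n+m sψ sφ) (m≤m+n _ sr)
    sr≤s : sr ≤ s
    sr≤s = m≤n+m sr (sφ + sψ)
    scaling : ∀ {Mφ' Mψr'} → Reproduces Mφ cφ kφ s Mφ' →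
              Reproduces Mψ cψ kψ s (proj₁ Mψr') × Reproduces Mr cr kr s (proj₂ Mψr') →
              ScaledBy A s (Mφ' , Mψr')
    scaling simφ (simψ , simr) = record
      { φ = φ ; ψ = ψ ; B = B ; ψ∘φ = ψ∘φ ; φ∘ψ = φ∘ψ ; B∘φ = B∘φ
      ; computes-φ = λ x → simφ x (hφ x)
      ; computes-ψ = λ y → simψ y (hψ y)
      ; ranks-B    = λ y → let o , halts , o≡rank = hr y in o , simr y halts , o≡rank
      }

-- Attacks on one length

update : ℕ → Word → (ℕ → Word) → ℕ → Word
update n w f m = if m ≡ᵇ n then w else f m

withoutLength : ℕ → Lang → Lang
withoutLength n L z = if length z ≡ᵇ n then false else L z

withoutLength-update : ∀ n w f z → z ≢ w →
                       withoutLength n (singletons f) z ≡ singletons (update n w f) z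
withoutLength-update n w f z z≢w with length z ≡ᵇ n
... | true  = sym (dec-false (w ≟ʷ z) (z≢w ∘ sym))
... | false = refl

singletons-true : ∀ f z → singletons f z ≡ true → f (length z) ≡ z
singletons-true f z member with f (length z) ≟ʷ z
... | yes fz≡z = fz≡z

singletons-intro : ∀ f z → f (length z) ≡ z → singletons f z ≡ true
singletons-intro f z fz≡z = dec-true (f (length z) ≟ʷ z) fz≡z

update-same : ∀ n w f → update n w f n ≡ w
update-same n w f = cong (if_then w else f n) (dec-true (n ≟ n) refl)

update-other : ∀ {m n} w f → m ≢ n → update n w f m ≡ f m
update-other {m} {n} w f m≢n = cong (if_then w else f m) (dec-false (m ≟ n) m≢n)

∈-concatMap : ∀ {A B : Set} (g : A → List B) {xs x z} → x ∈ xs → z ∈ g x → z ∈ concatMap g xs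
∈-concatMap g x∈xs z∈gx = ∈-concatMap⁺ g (Any.map (λ { refl → z∈gx }) x∈xs)

-- |φ w| ≤ imageBound for |w| = n; every word of length ≤ imageBound has index
-- below 2 ^ searchDepth; the words given to the rank and ψ machines have
-- length ≤ probeBound; their ψ-images have length ≤ preimageBound.
imageBound searchDepth probeBound preimageBound : ℕ → ℕ → ℕ
imageBound    s n = clock s n + suc n
searchDepth   s n = suc (imageBound s n)
probeBound    s n = suc (searchDepth s n)
preimageBound s n = clock s (probeBound s n) + suc (probeBound s n)

n≤preimageBound : ∀ s n → n ≤ preimageBound s n
n≤preimageBound s n = begin
  n                   ≤⟨ m≤n+m n (suc (clock s n)) ⟩
  suc (clock s n) + n ≡⟨ sym (+-suc (clock s n) n) ⟩
  imageBound s n      ≤⟨ n≤1+n _ ⟩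
  searchDepth s n     ≤⟨ n≤1+n _ ⟩
  probeBound s n      ≤⟨ m≤n+m _ (suc (clock s (probeBound s n))) ⟩
  suc (clock s (probeBound s n)) + probeBound s n ≡⟨ sym (+-suc _ _) ⟩
  preimageBound s n   ∎
  where open ≤-Reasoning

module Attack (s n : ℕ) (f : ℕ → Word) (Mφ Mψ Mr : OTM) where

  X : Lang
  X = withoutLength n (singletons f)

  known : List Word
  known = map f (filter (λ m → ¬? (m ≟ n)) (upTo (suc (preimageBound s n))))

  images : List Word
  images = map (output X Mφ s) known

  D : Lang
  D z = does (z ∈ʷ? images)

  -- If the triple scales A, then D is its image without φ w, so guess j
  -- holds exactly when index (φ w) ≤ j.
  guess : ℕ → Bool
  guess j = suc (rank D (wordAt j)) ≤ᵇ val (output X Mr s (wordAt j))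

  found : Word
  found = wordAt (bisect guess 0 (searchDepth s n))

  -- The attack's final answer counts as asked, too.
  φ-queries rank-queries ψ-queries queried : List Word
  φ-queries    = concatMap (asked X Mφ s) known
  rank-queries = concatMap (asked X Mr s ∘ wordAt) (probes guess 0 (searchDepth s n))
  ψ-queries    = asked X Mψ s found
  queried      = φ-queries ++ rank-queries ++ ψ-queries ++ [ output X Mψ s found ]

  ∈-known : ∀ {a} → a ∈ known → Σ ℕ λ m → m ≤ preimageBound s n × m ≢ n × a ≡ f m
  ∈-known a∈ with ∈-map⁻ f a∈
  ... | m , m∈ , refl with ∈-filter⁻ (λ m → ¬? (m ≟ n)) m∈
  ...   | m∈upTo , m≢n = m , s≤s⁻¹ (∈-upTo⁻ m∈upTo) , m≢n , refl

  known-∈ : ∀ {m} → m ≤ preimageBound s n → m ≢ n → f m ∈ known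
  known-∈ m≤ m≢n = ∈-map⁺ f (∈-filter⁺ (λ m → ¬? (m ≟ n)) (∈-upTo⁺ (s≤s m≤)) m≢n)

  D-true : ∀ {z} → D z ≡ true → Σ Word λ a → a ∈ known × output X Mφ s a ≡ z
  D-true {z} Dz with z ∈ʷ? images
  ... | yes z∈ = let a , a∈ , z≡ = ∈-map⁻ (output X Mφ s) z∈ in a , a∈ , sym z≡

  D-intro : ∀ {a z} → a ∈ known → output X Mφ s a ≡ z → D z ≡ true
  D-intro {z = z} a∈ refl = dec-true (z ∈ʷ? images) (∈-map⁺ (output X Mφ s) a∈)

  φ-asked⊆ : ∀ {a z} → a ∈ known → z ∈ asked X Mφ s a → z ∈ queried
  φ-asked⊆ a∈ z∈ = ∈-++⁺ˡ (∈-concatMap (asked X Mφ s) a∈ z∈)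

  rank-asked⊆ : ∀ {j z} → j ∈ probes guess 0 (searchDepth s n) → z ∈ asked X Mr s (wordAt j) →
                z ∈ queried
  rank-asked⊆ j∈ z∈ = ∈-++⁺ʳ φ-queries (∈-++⁺ˡ (∈-concatMap (asked X Mr s ∘ wordAt) j∈ z∈))

  ψ-asked⊆ : ∀ {z} → z ∈ ψ-queries → z ∈ queried
  ψ-asked⊆ z∈ = ∈-++⁺ʳ φ-queries (∈-++⁺ʳ rank-queries (∈-++⁺ˡ z∈))

  answer∈queried : output X Mψ s found ∈ queried
  answer∈queried = ∈-++⁺ʳ φ-queries (∈-++⁺ʳ rank-queries (∈-++⁺ʳ ψ-queries (here refl)))

attackQueries : ℕ → ℕ → (ℕ → Word) → Triple → List Word
attackQueries s n f (Mφ , Mψ , Mr) = Attack.queried s n f Mφ Mψ Mr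

suc-≤ᵇ-+bit : ∀ r c → (suc r ≤ᵇ r + bit c) ≡ c
suc-≤ᵇ-+bit r true  = dec-true (suc r ≤? r + 1) (≤-reflexive (+-comm 1 r))
suc-≤ᵇ-+bit r false = dec-false (suc r ≤? r + 0) (<⇒≱ (subst (_< suc r) (sym (+-identityʳ r)) (n<1+n r)))

-- As w is not asked, X answers every question of the attack as A does, so
-- all simulations are faithful and the attack ends up asking ψ (φ w) = w.
module Defeat
  (s n : ℕ) (f : ℕ → Word) (f-length : ∀ m → length (f m) ≡ m)
  (w : Word) (w-length : length w ≡ n)
  (A : Lang) (A-short : ∀ z → length z ≤ preimageBound s n → A z ≡ singletons (update n w f) z)
  (Mφ Mψ Mr : OTM)
  (A-queried : All (λ z → A z ≡ singletons (update n w f) z) (Attack.queried s n f Mφ Mψ Mr))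
  (w-fresh : w ∉ Attack.queried s n f Mφ Mψ Mr)
  (scaling : Scaling A s Mφ Mψ Mr)
  where

  open Attack s n f Mφ Mψ Mr
  open Scaling scaling

  T P d : ℕ
  T = preimageBound s n
  P = probeBound s n
  d = searchDepth s n

  X≡A : ∀ {zs} → (∀ {z} → z ∈ zs → z ∈ queried) → All (λ z → X z ≡ A z) zs
  X≡A ⊆queried = All.tabulate λ {z} z∈ →
    trans (withoutLength-update n w f z (λ { refl → w-fresh (⊆queried z∈) }))
          (sym (All.lookup A-queried (⊆queried z∈)))

  simulated-φ : ∀ {a} → a ∈ known → output X Mφ s a ≡ φ a
  simulated-φ {a} a∈ =
    trans (output-agree X A Mφ s a (X≡A (φ-asked⊆ a∈))) (cong (fromMaybe []) (computes-φ a))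

  A-update : ∀ z → length z ≤ T → A z ≡ true → update n w f (length z) ≡ z
  A-update z short Az = singletons-true (update n w f) z (trans (sym (A-short z short)) Az)

  A-w : A w ≡ true
  A-w = trans (A-short w (subst (_≤ T) (sym w-length) (n≤preimageBound s n)))
              (singletons-intro (update n w f) w (trans (cong (update n w f) w-length) (update-same n w f)))

  A-f : ∀ {m} → m ≤ T → m ≢ n → A (f m) ≡ true
  A-f {m} m≤T m≢n =
    trans (A-short (f m) (subst (_≤ T) (sym (f-length m)) m≤T))
          (singletons-intro (update n w f) (f m) (trans (cong (update n w f) (f-length m)) (update-other w f m≢n)))

  A-known : ∀ {a} → a ∈ known → A a ≡ true
  A-known a∈ = let m , m≤T , m≢n , a≡fm = ∈-known a∈ in
    subst (λ a → A a ≡ true) (sym a≡fm) (A-f m≤T m≢n)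

  length-known : ∀ {a} → a ∈ known → length a ≢ n
  length-known a∈ |a|≡n = let m , _ , m≢n , a≡fm = ∈-known a∈ in
    m≢n (trans (sym (trans (cong length a≡fm) (f-length m))) |a|≡n)

  φ-injective : ∀ {a a'} → φ a ≡ φ a' → a ≡ a'
  φ-injective {a} {a'} φa≡φa' = trans (sym (ψ∘φ a)) (trans (cong ψ φa≡φa') (ψ∘φ a'))

  b : Word
  b = φ w

  b-short : length b ≤ imageBound s n
  b-short = subst (λ l → length b ≤ clock s l + suc l) w-length (length-output A Mφ _ w (computes-φ w))

  ψ-short : ∀ z → length z ≤ P → length (ψ z) ≤ T
  ψ-short z z≤P = ≤-trans (length-output A Mψ _ z (computes-ψ z)) (+-mono-≤ (clock-mono s z≤P) (s≤s z≤P))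

  A-ψ : ∀ {z} → B z ≡ true → A (ψ z) ≡ true
  A-ψ {z} Bz = trans (sym (B∘φ (ψ z))) (trans (cong B (φ∘ψ z)) Bz)

  B-true : ∀ z → length z ≤ P → B z ≡ true → D z ≡ true ⊎ b ≡ z
  B-true z z≤P Bz with length (ψ z) ≟ n
  ... | yes |ψz|≡n = inj₂ (trans (cong φ (sym ψz≡w)) (φ∘ψ z))
    where
    ψz≡w : ψ z ≡ w
    ψz≡w = trans (sym (A-update (ψ z) (ψ-short z z≤P) (A-ψ Bz)))
                 (trans (cong (update n w f) |ψz|≡n) (update-same n w f))
  ... | no  |ψz|≢n = inj₁ (D-intro ψz∈known (trans (simulated-φ ψz∈known) (φ∘ψ z)))
    where
    ψz∈known : ψ z ∈ known
    ψz∈known = subst (_∈ known)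
                     (trans (sym (update-other w f |ψz|≢n)) (A-update (ψ z) (ψ-short z z≤P) (A-ψ Bz)))
                     (known-∈ (ψ-short z z≤P) |ψz|≢n)

  D-true⇒B : ∀ {z} → D z ≡ true → B z ≡ true
  D-true⇒B Dz = let a , a∈ , φXa≡z = D-true Dz in
    subst (λ z → B z ≡ true) (trans (sym (simulated-φ a∈)) φXa≡z) (trans (B∘φ a) (A-known a∈))

  B-short : ∀ z → length z ≤ P → B z ≡ (D z ∨ does (b ≟ʷ z))
  B-short z z≤P with B z in Bz | D z in Dz | b ≟ʷ z
  ... | true  | true  | _        = refl
  ... | true  | false | yes _    = refl
  ... | true  | false | no  b≢z  with B-true z z≤P Bz
  ...   | inj₁ Dz-true = contradiction (trans (sym Dz-true) Dz) λ ()
  ...   | inj₂ b≡z     = contradiction b≡z b≢z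
  B-short z z≤P | false | true  | _        = contradiction (trans (sym (D-true⇒B Dz)) Bz) λ ()
  B-short z z≤P | false | false | yes refl = contradiction (trans (sym (trans (B∘φ w) A-w)) Bz) λ ()
  B-short z z≤P | false | false | no  _    = refl

  D-b : D b ≡ false
  D-b = ¬-not λ Db → let a , a∈ , φXa≡b = D-true Db in
    length-known a∈ (trans (cong length (φ-injective (trans (sym (simulated-φ a∈)) φXa≡b))) w-length)

  ranks : ∀ {j} → j ∈ probes guess 0 d →
          val (output X Mr s (wordAt j)) ≡ rank D (wordAt j) + bit (b ≤std wordAt j)
  ranks {j} j∈ with ranks-B (wordAt j)
  ... | o , halts , o≡rank = begin
    val (output X Mr s y) ≡⟨ cong val (output-agree X A Mr s y (X≡A (rank-asked⊆ j∈))) ⟩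
    val (output A Mr s y) ≡⟨ cong (val ∘ fromMaybe []) halts ⟩
    val o                 ≡⟨ o≡rank ⟩
    rank B y              ≡⟨ rank-∪-singleton B D b y (λ z short → B-short z (≤-trans short |y|≤P)) D-b ⟩
    rank D y + bit (b ≤std y) ∎
    where
    open ≡-Reasoning
    y : Word
    y = wordAt j
    |y|≤P : length y ≤ P
    |y|≤P = ≤-trans (length-wordAt j (All.lookup (probes< guess 0 d) j∈)) (n≤1+n d)

  guess-threshold : ∀ {j} → j ∈ probes guess 0 d → guess j ≡ (index b ≤ᵇ j)
  guess-threshold {j} j∈ = begin
    suc (rank D y) ≤ᵇ val (output X Mr s y)    ≡⟨ cong (suc (rank D y) ≤ᵇ_) (ranks j∈) ⟩
    suc (rank D y) ≤ᵇ rank D y + bit (b ≤std y) ≡⟨ suc-≤ᵇ-+bit (rank D y) (b ≤std y) ⟩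
    b ≤std y                                   ≡⟨ ≤std-index b y ⟩
    index b ≤ᵇ index y                         ≡⟨ cong (index b ≤ᵇ_) (index-wordAt j) ⟩
    index b ≤ᵇ j                               ∎
    where
    open ≡-Reasoning
    y : Word
    y = wordAt j

  found≡b : found ≡ b
  found≡b = trans (cong wordAt (bisect-threshold guess (index b) 0 d z≤n (<⇒≤ (index<2^ b (s≤s b-short)))
                                                 (All.tabulate guess-threshold)))
                  (wordAt-index b)

  recovers-w : output X Mψ s found ≡ w
  recovers-w = begin
    output X Mψ s found ≡⟨ output-agree X A Mψ s found (X≡A ψ-asked⊆) ⟩
    output A Mψ s found ≡⟨ cong (fromMaybe []) (computes-ψ found) ⟩
    ψ found             ≡⟨ cong ψ found≡b ⟩
    ψ (φ w)             ≡⟨ ψ∘φ w ⟩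
    w                   ∎
    where open ≡-Reasoning

  absurd : ⊥
  absurd = w-fresh (subst (_∈ queried) recovers-w answer∈queried)

length-concatMap≤ : ∀ {A B : Set} (g : A → List B) {xs} K → All (λ a → length (g a) ≤ K) xs →
                    length (concatMap g xs) ≤ length xs * K
length-concatMap≤ g K []               = z≤n
length-concatMap≤ g K (short ∷ shorts) =
  ≤-trans (≤-reflexive (length-++ (g _))) (+-mono-≤ short (length-concatMap≤ g K shorts))

attackCost : ℕ → ℕ → ℕ
attackCost s n = suc (preimageBound s n) * clock s (preimageBound s n)
               + (probeBound s n * clock s (probeBound s n) + (clock s (probeBound s n) + 1))

module _ (s n : ℕ) (f : ℕ → Word) (f-length : ∀ m → length (f m) ≡ m) (Mφ Mψ Mr : OTM) where
  open Attack s n f Mφ Mψ Mr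

  private
    T P d : ℕ
    T = preimageBound s n
    P = probeBound s n
    d = searchDepth s n

  length-φ-queries : length φ-queries ≤ suc T * clock s T
  length-φ-queries = ≤-trans (length-concatMap≤ (asked X Mφ s) (clock s T) (All.tabulate short-asked))
                             (*-monoˡ-≤ (clock s T) length-known)
    where
    short-asked : ∀ {a} → a ∈ known → length (asked X Mφ s a) ≤ clock s T
    short-asked a∈ with ∈-known a∈
    ... | m , m≤T , _ , refl = length-asked X Mφ s (f m) (subst (_≤ T) (sym (f-length m)) m≤T)
    length-known : length known ≤ suc T
    length-known = begin
      length known   ≡⟨ length-map f (filter (λ m → ¬? (m ≟ n)) (upTo (suc T))) ⟩
      length (filter (λ m → ¬? (m ≟ n)) (upTo (suc T)))
        ≤⟨ length-filter (λ m → ¬? (m ≟ n)) (upTo (suc T)) ⟩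
      length (upTo (suc T)) ≡⟨ length-upTo (suc T) ⟩
      suc T          ∎
      where open ≤-Reasoning

  length-rank-queries : length rank-queries ≤ P * clock s P
  length-rank-queries = begin
    length rank-queries                          ≤⟨ length-concatMap≤ (asked X Mr s ∘ wordAt) (clock s P)
                                                      (All.map short-asked (probes< guess 0 d)) ⟩
    length (probes guess 0 d) * clock s P        ≡⟨ cong (_* clock s P) (length-probes guess 0 d) ⟩
    P * clock s P                                ∎
    where
    open ≤-Reasoning
    short-asked : ∀ {j} → j < 2 ^ d → length (asked X Mr s (wordAt j)) ≤ clock s P
    short-asked {j} j< = length-asked X Mr s (wordAt j) (≤-trans (length-wordAt j j<) (n≤1+n d))

  length-found : length found ≤ P
  length-found = length-wordAt _ (≤-<-trans (bisect≤ guess 0 d) (^-monoʳ-< 2 (s≤s (s≤s z≤n)) (n<1+n d)))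

  length-queried : length queried ≤ attackCost s n
  length-queried = begin
    length (φ-queries ++ rank-queries ++ ψ-queries ++ [ output X Mψ s found ])
      ≡⟨ length-++ φ-queries ⟩
    length φ-queries + length (rank-queries ++ ψ-queries ++ [ output X Mψ s found ])
      ≡⟨ cong (length φ-queries +_) (length-++ rank-queries) ⟩
    length φ-queries + (length rank-queries + length (ψ-queries ++ [ output X Mψ s found ]))
      ≡⟨ cong (λ l → length φ-queries + (length rank-queries + l)) (length-++ ψ-queries) ⟩
    length φ-queries + (length rank-queries + (length ψ-queries + 1))
      ≤⟨ +-mono-≤ length-φ-queries (+-mono-≤ length-rank-queries
                                      (+-monoˡ-≤ 1 (length-asked X Mψ s found length-found))) ⟩
    attackCost s n ∎
    where open ≤-Reasoning

poly-clock : ∀ s → PolyBounded (clock s)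
poly-clock s = poly-+ (s , s , λ m → ≤-refl) (poly-const s)

poly-probeBound : ∀ s → PolyBounded (probeBound s)
poly-probeBound s = poly-∘ poly-suc (poly-∘ poly-suc (poly-+ (poly-clock s) poly-suc))

poly-preimageBound : ∀ s → PolyBounded (preimageBound s)
poly-preimageBound s = poly-+ (poly-∘ (poly-clock s) (poly-probeBound s)) (poly-∘ poly-suc (poly-probeBound s))

poly-attackCost : ∀ s → PolyBounded (attackCost s)
poly-attackCost s =
  poly-+ (poly-* (poly-∘ poly-suc (poly-preimageBound s)) (poly-∘ (poly-clock s) (poly-preimageBound s)))
         (poly-+ (poly-* (poly-probeBound s) (poly-∘ (poly-clock s) (poly-probeBound s)))
                 (poly-+ (poly-∘ (poly-clock s) (poly-probeBound s)) (poly-const 1)))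

-- The oracle A

allQueries : ℕ → ℕ → (ℕ → Word) → List Word
allQueries s n f = concatMap (attackQueries s n f) (triples s)

totalCost : ℕ → ℕ → ℕ
totalCost s n = length (triples s) * attackCost s n

length-allQueries : ∀ s n f → (∀ m → length (f m) ≡ m) → length (allQueries s n f) ≤ totalCost s n
length-allQueries s n f f-length = length-concatMap≤ (attackQueries s n f) {triples s} (attackCost s n)
  (All.tabulate λ { {Mφ , Mψ , Mr} _ → length-queried s n f f-length Mφ Mψ Mr })

poly-totalCost : ∀ s → PolyBounded (totalCost s)
poly-totalCost s = poly-* (poly-const (length (triples s))) (poly-attackCost s)

update-length : ∀ {n w} f → length w ≡ n → (∀ m → length (f m) ≡ m) →
                ∀ m → length (update n w f m) ≡ m
update-length {n} {w} f |w|≡n f-length m with m ≟ n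
... | yes refl = trans (cong length (update-same m w f)) |w|≡n
... | no  m≢n  = trans (cong length (update-other w f m≢n)) (f-length m)

-- Lengths from the frontier on still carry their initial word.
record Approximation : Set where
  constructor ⟨_,_⟩
  field
    frontier : ℕ
    table    : ℕ → Word
open Approximation

module Stage (s : ℕ) (a : Approximation) where

  n : ℕ
  n = crossover (poly-totalCost s) (frontier a)

  Q : List Word
  Q = allQueries s n (table a)

  w : Word
  w = freshWord n Q

  next : Approximation
  next = ⟨ suc (preimageBound s n + length (argmax length [] Q)) , update n w (table a) ⟩

stage : ℕ → Approximation
stage zero    = ⟨ 0 , (λ m → replicate m false) ⟩
stage (suc s) = Stage.next s (stage s)

table-length : ∀ s m → length (table (stage s) m) ≡ m
table-length zero    m = length-replicate m
table-length (suc s) = update-length (table (stage s)) (length-freshWord _ _) (table-length s)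

frontier≤n : ∀ s → frontier (stage s) ≤ Stage.n s (stage s)
frontier≤n s = crossover-≥ (poly-totalCost s) (frontier (stage s))

preimageBound<frontier : ∀ s → preimageBound s (Stage.n s (stage s)) < frontier (stage (suc s))
preimageBound<frontier s = s≤s (m≤m+n _ (length (argmax length [] (Stage.Q s (stage s)))))

queried<frontier : ∀ s {z} → z ∈ Stage.Q s (stage s) → length z < frontier (stage (suc s))
queried<frontier s z∈ = s≤s (≤-trans (All.lookup (f[xs]≤f[argmax] {f = length} [] (Stage.Q s (stage s))) z∈)
                                    (m≤n+m _ (preimageBound s (Stage.n s (stage s)))))

frontier-step : ∀ s → frontier (stage s) < frontier (stage (suc s))
frontier-step s =
  ≤-<-trans (≤-trans (frontier≤n s) (n≤preimageBound s (Stage.n s (stage s)))) (preimageBound<frontier s)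

frontier-mono : ∀ {s s'} → s ≤′ s' → frontier (stage s) ≤ frontier (stage s')
frontier-mono ≤′-refl         = ≤-refl
frontier-mono (≤′-step {s'} s≤′s') = ≤-trans (frontier-mono s≤′s') (<⇒≤ (frontier-step s'))

s≤frontier : ∀ s → s ≤ frontier (stage s)
s≤frontier zero    = z≤n
s≤frontier (suc s) = ≤-<-trans (s≤frontier s) (frontier-step s)

table-stable : ∀ {s s' m} → s ≤′ s' → m < frontier (stage s) → table (stage s') m ≡ table (stage s) m
table-stable ≤′-refl                 m<frontier = refl
table-stable {s} (≤′-step {s'} s≤′s') m<frontier =
  trans (update-other _ (table (stage s')) m≢n) (table-stable s≤′s' m<frontier)
  where
  m≢n : _ ≢ Stage.n s' (stage s')
  m≢n = <⇒≢ (<-≤-trans m<frontier (≤-trans (frontier-mono s≤′s') (frontier≤n s')))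

-- Stage m + 1 moves the frontier past m, so this word is never changed again.
finalWord : ℕ → Word
finalWord m = table (stage (suc m)) m

A : Lang
A = singletons finalWord

A-stage : ∀ s z → length z < frontier (stage s) → A z ≡ singletons (table (stage s)) z
A-stage s z short = cong (λ v → does (v ≟ʷ z))
  (trans (sym (table-stable (≤⇒≤′ (m≤m⊔n (suc m) s)) (s≤frontier (suc m))))
         (table-stable (≤⇒≤′ (m≤n⊔m (suc m) s)) short))
  where
  m : ℕ
  m = length z

module Diagonal (s : ℕ) {Mφ Mψ Mr : OTM} (τ∈ : (Mφ , Mψ , Mr) ∈ triples s) where
  open Stage s (stage s)

  private
    f : ℕ → Word
    f = table (stage s)

    ∈-Q : ∀ {z} → z ∈ attackQueries s n f (Mφ , Mψ , Mr) → z ∈ Q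
    ∈-Q = ∈-concatMap (attackQueries s n f) τ∈

    A-short : ∀ z → length z ≤ preimageBound s n → A z ≡ singletons (update n w f) z
    A-short z short = A-stage (suc s) z (≤-<-trans short (preimageBound<frontier s))

    A-queried : All (λ z → A z ≡ singletons (update n w f) z) (attackQueries s n f (Mφ , Mψ , Mr))
    A-queried = All.tabulate λ {z} z∈ → A-stage (suc s) z (queried<frontier s (∈-Q z∈))

    w-fresh : w ∉ attackQueries s n f (Mφ , Mψ , Mr)
    w-fresh w∈ = freshWord∉ n Q (≤-<-trans (length-allQueries s n f (table-length s))
                                          (crossover-< (poly-totalCost s) (frontier (stage s))))
                              (∈-Q w∈)

  defeated : ¬ Scaling A s Mφ Mψ Mr
  defeated = Defeat.absurd s n f (table-length s) w (length-freshWord n Q) A A-short Mφ Mψ Mr A-queried w-fresh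

stage-defeats : ∀ s {τ} → τ ∈ triples s → ¬ ScaledBy A s τ
stage-defeats s {Mφ , Mψ , Mr} = Diagonal.defeated s

A-not-scalable : ¬ Scalable A A
A-not-scalable scalable =
  let s , scaled          = scalable⇒scaledBy A scalable
      _ , τ∈ , τ-scales = find scaled
  in stage-defeats s τ∈ τ-scales

-- Writes 1, blanks the next cell and steps back: the output is 1.
writeOne : OTM
writeOne = record { nStates = 3 ; start = zero ; δ = δ }
  where
  δ : Fin 3 → Sym → Sym → Bool → Action 3
  δ zero             _ _ _ = go (suc zero) b1 right blank stay
  δ (suc zero)       _ _ _ = go (suc (suc zero)) blank left blank stay
  δ (suc (suc zero)) _ _ _ = halt

census-A : CensusInFP A A
census-A = writeOne , 4 , 0 , λ n → true ∷ [] , refl , sym (census-singletons finalWord n (table-length (suc n) n))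

theorem5p5 : Σ Lang λ A → ¬ Scalable A A × CensusInFP A A
theorem5p5 = A , A-not-scalable , census-A
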